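{- Let $n\ge1$, $i,j\in\{ -n-1,\dots,n+1\}$ and $R_i$ as in the context. If $|j|=|i|$ then $R_i\circ R_j=R_{\min\{i,j\}}$.
   Context: For $p=(p_1,\dots,p_n)\in\mathbb Q^n$: $(p,q)\in L_1$ iff $p_1<q_1$; for $2\le i\le n$, $(p,q)\in L_i$ iff $(p_1,\dots,p_{i-1})=(q_1,\dots,q_{i-1})$ and $p_i<q_i$. Let $<_n=L_1\cup\dots\cup L_n$. $X=\mathbb Q^n\times\{ -1,1\}$, writing $p^b$ for $(p,b)$, with $p^b\le_X q^d$ iff $p^b=q^d$ or $p<_nq$; $\alpha(p^b)=p^{ -b}$. For $R\subseteq X^2$, $R^c=X^2\setminus R$, $R^\smile$ the converse, $\circ$ relational composition. $U_j=\{(p^b,q^d)\mid b,d\in\{ -1,1\},(p,q)\in L_j\}$. $R_{ -n-1}=\varnothing$; $R_i=\bigcup_{j=1}^{n+1+i}U_j$ for $-n\le i\le-1$; $R_0={\le_X}$; $R_i=(R_{ -i})^{c\smile}\circ\alpha$ for $1\le i\le n+1$. -}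

module Defs where

open import Data.Nat as ℕ using (ℕ; zero; suc; _∸_)
open import Data.Fin using (Fin; toℕ)
open import Data.Vec using (Vec; lookup)
open import Data.Rational as ℚ using (ℚ)
open import Data.Integer as ℤ using (ℤ; +_; -[1+_]; +[1+_])
open import Data.Sign using (Sign; opposite)
open import Data.Product using (_×_; _,_; ∃; ∃-syntax)
open import Data.Sum using (_⊎_)
open import Data.Empty using (⊥)
open import Relation.Nullary using (¬_)
open import Relation.Binary.PropositionalEquality using (_≡_)

-- ℚ^n as vectors; X = ℚ^n × {-1,1}  (the sign set {-1,1} is Data.Sign.Sign)
ℚ^ : ℕ → Set
ℚ^ n = Vec ℚ n

X : ℕ → Set
X n = ℚ^ n × Sign

Rel : ℕ → Set₁
Rel n = X n → X n → Set

_∘ᵣ_ : ∀ {n} → Rel n → Rel n → Rel n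
(R ∘ᵣ S) x z = ∃[ y ] (R x y × S y z)

_ᶜ : ∀ {n} → Rel n → Rel n
(R ᶜ) x y = ¬ R x y

_⌣ : ∀ {n} → Rel n → Rel n
(R ⌣) x y = R y x

α : ∀ {n} → X n → X n
α (p , b) = p , opposite b

αRel : ∀ {n} → Rel n
αRel x y = y ≡ α x

-- L_{k+1} for k : Fin n (0-based index k, i.e. paper's index j = k+1):
-- the first k coordinates agree and coordinate k is strictly smaller
L : ∀ {n} → Fin n → ℚ^ n → ℚ^ n → Set
L {n} k p q = (∀ (m : Fin n) → toℕ m ℕ.< toℕ k → lookup p m ≡ lookup q m)
            × lookup p k ℚ.< lookup q k

_<ₙ_ : ∀ {n} → ℚ^ n → ℚ^ n → Set
_<ₙ_ {n} p q = ∃[ k ] L {n} k p q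

_≤X_ : ∀ {n} → Rel n
x ≤X y = x ≡ y ⊎ (Data.Product.proj₁ x <ₙ Data.Product.proj₁ y)

U : ∀ {n} → Fin n → Rel n
U k (p , b) (q , d) = L k p q

-- R_i for i ∈ ℤ (only meaningful for -n-1 ≤ i ≤ n+1):
--   i = -(m+1) :  ⋃_{j=1}^{n+1+i} U_j = ⋃ { U_{k+1} | k+1 ≤ n - m }
--                 (empty when i = -n-1, so R_{-n-1} = ∅)
--   i = 0      :  ≤_X
--   i = m+1    :  (R_{-(m+1)})^{c⌣} ∘ α
R : (n : ℕ) → ℤ → Rel n
R n -[1+ m ] x y = ∃[ k ] (toℕ k ℕ.< n ∸ m × U {n} k x y)
R n (+ zero) = _≤X_
R n +[1+ m ] = ((R n -[1+ m ]) ᶜ ⌣) ∘ᵣ αRel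

{-# OPTIONS --safe #-}
module Submission where

open import Defs
open import Data.Nat using (ℕ)
open import Data.Integer using (ℤ; _≤_; -[1+_]; +[1+_]; ∣_∣; _⊓_)
open import Data.Product using (_×_)
open import Relation.Binary.PropositionalEquality using (_≡_)

open import Data.Nat as ℕ using (zero; suc; _∸_)
import Data.Nat.Properties as ℕ
open import Data.Integer using (+_)
open import Data.Fin using (Fin; toℕ; fromℕ<)
open import Data.Fin.Properties using (toℕ-injective; toℕ-fromℕ<)
open import Data.Vec using (lookup; _[_]≔_)
open import Data.Vec.Properties using (lookup∘update; lookup∘update′)
import Data.Rational as ℚ
import Data.Rational.Properties as ℚ
open import Data.Sign using (Sign)
open import Data.Product using (_,_; proj₁; proj₂; ∃-syntax)
open import Data.Sum using (_⊎_; inj₁; inj₂)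
open import Relation.Nullary using (¬_; contradiction)
open import Relation.Binary.Definitions
  using (Reflexive; Transitive; tri<; tri≈; tri>)
open import Relation.Binary.PropositionalEquality using (refl; sym; trans; subst)

-- Since α leaves the ℚ^n-component alone, R_{-(m+1)} and R_{m+1} only look at
-- that component: with ≺ the lexicographic order on the first n ∸ m coordinates,
-- x R_{-(m+1)} y iff x ≺ y, and x R_{m+1} y iff ¬ y ≺ x.  The relation ≺ is
-- irreflexive, transitive, dense (as ℚ is) and cotransitive (p ≺ r gives p ≺ q
-- or q ≺ r, by comparing q with p), and these properties alone yield ≺∘≺ = ≺,
-- ≺∘⊀ = ⊀∘≺ = ≺ and ⊀∘⊀ = ⊀.  Finally ≤_X is a preorder, so R_0∘R_0 = R_0.

_≐_ : ∀ {n} → Rel n → Rel n → Set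
S ≐ T = ∀ x y → (S x y → T x y) × (T x y → S x y)

module _ {n : ℕ} where

  preorder-∘-idem : {S : Rel n} → Reflexive S → Transitive S → (S ∘ᵣ S) ≐ S
  preorder-∘-idem refl′ trans′ x z = (λ (_ , s₁ , s₂) → trans′ s₁ s₂) , λ s → x , refl′ , s

  α-involutive : (x : X n) → α (α x) ≡ x
  α-involutive (_ , Sign.+) = refl
  α-involutive (_ , Sign.-) = refl

  module _ (_<_ : ℚ^ n → ℚ^ n → Set) where

    Strict : Rel n
    Strict x y = proj₁ x < proj₁ y

    Weak : Rel n
    Weak = ((Strict ᶜ) ⌣) ∘ᵣ αRel

    Strict∘Strict : (∀ p q r → p < q → q < r → p < r) →
                    (∀ p r → p < r → ∃[ q ] (p < q × q < r)) →
                    (Strict ∘ᵣ Strict) ≐ Strict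
    Strict∘Strict <-trans <-dense x z = to , from
      where
      to : (Strict ∘ᵣ Strict) x z → Strict x z
      to (y , x<y , y<z) = <-trans (proj₁ x) (proj₁ y) (proj₁ z) x<y y<z
      from : Strict x z → (Strict ∘ᵣ Strict) x z
      from x<z = let (q , x<q , q<z) = <-dense (proj₁ x) (proj₁ z) x<z
                 in (q , proj₂ x) , x<q , q<z

    module _ (<-irrefl : ∀ p → ¬ p < p) (<-cotrans : ∀ p r → p < r → ∀ q → p < q ⊎ q < r) where

      Strict∘Weak : (Strict ∘ᵣ Weak) ≐ Strict
      Strict∘Weak x z = to , from
        where
        to : (Strict ∘ᵣ Weak) x z → Strict x z
        to (y , x<y , w , w≮y , refl) with <-cotrans (proj₁ x) (proj₁ y) x<y (proj₁ w)
        ... | inj₁ x<w = x<w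
        ... | inj₂ w<y = contradiction w<y w≮y
        from : Strict x z → (Strict ∘ᵣ Weak) x z
        from x<z = z , x<z , α z , <-irrefl (proj₁ z) , sym (α-involutive z)

      Weak∘Strict : (Weak ∘ᵣ Strict) ≐ Strict
      Weak∘Strict x z = to , from
        where
        to : (Weak ∘ᵣ Strict) x z → Strict x z
        to (_ , (w , w≮x , refl) , w<z) with <-cotrans (proj₁ w) (proj₁ z) w<z (proj₁ x)
        ... | inj₁ w<x = contradiction w<x w≮x
        ... | inj₂ x<z = x<z
        from : Strict x z → (Weak ∘ᵣ Strict) x z
        from x<z = x , (α x , <-irrefl (proj₁ x) , sym (α-involutive x)) , x<z

      Weak∘Weak : (Weak ∘ᵣ Weak) ≐ Weak
      Weak∘Weak x z = to , from
        where
        to : (Weak ∘ᵣ Weak) x z → Weak x z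
        to (_ , (w , w≮x , refl) , v , v≮w , z≡αv) = v , v≮x , z≡αv
          where
          v≮x : ¬ (proj₁ v < proj₁ x)
          v≮x v<x with <-cotrans (proj₁ v) (proj₁ x) v<x (proj₁ w)
          ... | inj₁ v<w = v≮w v<w
          ... | inj₂ w<x = w≮x w<x
        from : Weak x z → (Weak ∘ᵣ Weak) x z
        from x≾z = α x , (x , <-irrefl (proj₁ x) , refl) , x≾z

  _≈[_]_ : ℚ^ n → ℕ → ℚ^ n → Set
  p ≈[ K ] q = ∀ (m : Fin n) → toℕ m ℕ.< K → lookup p m ≡ lookup q m

  _≺[_]_ : ℚ^ n → ℕ → ℚ^ n → Set
  p ≺[ K ] q = ∃[ k ] (toℕ k ℕ.< K × L k p q)

  ≈-sym : ∀ {K} (p q : ℚ^ n) → p ≈[ K ] q → q ≈[ K ] p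
  ≈-sym _ _ p≈q m m<K = sym (p≈q m m<K)

  ≈-trans : ∀ {K} (p q r : ℚ^ n) → p ≈[ K ] q → q ≈[ K ] r → p ≈[ K ] r
  ≈-trans _ _ _ p≈q q≈r m m<K = trans (p≈q m m<K) (q≈r m m<K)

  ≈-mono : ∀ {K K′} (p q : ℚ^ n) → K′ ℕ.≤ K → p ≈[ K ] q → p ≈[ K′ ] q
  ≈-mono _ _ K′≤K p≈q m m<K′ = p≈q m (ℕ.<-≤-trans m<K′ K′≤K)

  ≈-extend : ∀ (p q : ℚ^ n) (k : Fin n) → p ≈[ toℕ k ] q → lookup p k ≡ lookup q k →
             p ≈[ suc (toℕ k) ] q
  ≈-extend _ _ k p≈q pk≡qk m m<1+k with ℕ.m<1+n⇒m<n∨m≡n m<1+k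
  ... | inj₁ m<k = p≈q m m<k
  ... | inj₂ m≡k rewrite toℕ-injective m≡k = pk≡qk

  L-irrefl : ∀ {k : Fin n} (p : ℚ^ n) → ¬ L k p p
  L-irrefl _ (_ , pk<pk) = ℚ.<-irrefl refl pk<pk

  L-trans : ∀ {k₁ k₂ : Fin n} (p q r : ℚ^ n) → L k₁ p q → L k₂ q r →
            ∃[ k ] (toℕ k ℕ.≤ toℕ k₁ × L k p r)
  L-trans {k₁} {k₂} p q r (p≈q , pk₁<qk₁) (q≈r , qk₂<rk₂) with ℕ.<-cmp (toℕ k₁) (toℕ k₂)
  ... | tri< k₁<k₂ _ _ =
    k₁ , ℕ.≤-refl , ≈-trans p q r p≈q (≈-mono q r (ℕ.<⇒≤ k₁<k₂) q≈r) ,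
    subst (lookup p k₁ ℚ.<_) (q≈r k₁ k₁<k₂) pk₁<qk₁
  ... | tri> _ _ k₂<k₁ =
    k₂ , ℕ.<⇒≤ k₂<k₁ , ≈-trans p q r (≈-mono p q (ℕ.<⇒≤ k₂<k₁) p≈q) q≈r ,
    subst (ℚ._< lookup r k₂) (sym (p≈q k₂ k₂<k₁)) qk₂<rk₂
  ... | tri≈ _ k₁≡k₂ _ rewrite toℕ-injective k₁≡k₂ =
    k₂ , ℕ.≤-refl , ≈-trans p q r p≈q q≈r , ℚ.<-trans pk₁<qk₁ qk₂<rk₂

  L-dense : ∀ {k : Fin n} (p r : ℚ^ n) → L k p r → ∃[ q ] (L k p q × L k q r)
  L-dense {k} p r (p≈r , pk<rk) with ℚ.<-dense pk<rk
  ... | c , pk<c , c<rk =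
    q , (p≈q , subst (lookup p k ℚ.<_) (sym qk≡c) pk<c)
      , (≈-trans q p r (≈-sym p q p≈q) p≈r , subst (ℚ._< lookup r k) (sym qk≡c) c<rk)
    where
    q = p [ k ]≔ c
    qk≡c : lookup q k ≡ c
    qk≡c = lookup∘update k p c
    p≈q : p ≈[ toℕ k ] q
    p≈q m m<k = sym (lookup∘update′ (λ { refl → ℕ.<-irrefl refl m<k }) p c)

  ≺-irrefl : ∀ {K} (p : ℚ^ n) → ¬ p ≺[ K ] p
  ≺-irrefl p (_ , _ , p<p) = L-irrefl p p<p

  ≺-trans : ∀ {K} (p q r : ℚ^ n) → p ≺[ K ] q → q ≺[ K ] r → p ≺[ K ] r
  ≺-trans p q r (_ , k₁<K , p<q) (_ , _ , q<r) =
    let (k , k≤k₁ , p<r) = L-trans p q r p<q q<r in k , ℕ.≤-<-trans k≤k₁ k₁<K , p<r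

  ≺-dense : ∀ {K} (p r : ℚ^ n) → p ≺[ K ] r → ∃[ q ] (p ≺[ K ] q × q ≺[ K ] r)
  ≺-dense p r (k , k<K , p<r) =
    let (q , p<q , q<r) = L-dense p r p<r in q , (k , k<K , p<q) , (k , k<K , q<r)

  ≈-≺-trans : ∀ {K} (p q r : ℚ^ n) → p ≈[ K ] q → q ≺[ K ] r → p ≺[ K ] r
  ≈-≺-trans p q r p≈q (k , k<K , q≈r , qk<rk) =
    k , k<K , ≈-trans p q r (≈-mono p q (ℕ.<⇒≤ k<K) p≈q) q≈r ,
    subst (ℚ._< lookup r k) (sym (p≈q k k<K)) qk<rk

  ≺-mono : ∀ {K K′} (p q : ℚ^ n) → K ℕ.≤ K′ → p ≺[ K ] q → p ≺[ K′ ] q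
  ≺-mono _ _ K≤K′ (k , k<K , p<q) = k , ℕ.<-≤-trans k<K K≤K′ , p<q

  Comparison : ℕ → ℚ^ n → ℚ^ n → Set
  Comparison K p q = p ≺[ K ] q ⊎ p ≈[ K ] q ⊎ q ≺[ K ] p

  compare-next : ∀ {K} (p q : ℚ^ n) (k : Fin n) → toℕ k ≡ K → p ≈[ K ] q → Comparison (suc K) p q
  compare-next p q k refl p≈q with ℚ.<-cmp (lookup p k) (lookup q k)
  ... | tri< pk<qk _ _ = inj₁ (k , ℕ.n<1+n _ , p≈q , pk<qk)
  ... | tri≈ _ pk≡qk _ = inj₂ (inj₁ (≈-extend p q k p≈q pk≡qk))
  ... | tri> _ _ qk<pk = inj₂ (inj₂ (k , ℕ.n<1+n _ , ≈-sym p q p≈q , qk<pk))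

  compare : ∀ {K} → K ℕ.≤ n → ∀ (p q : ℚ^ n) → Comparison K p q
  compare {zero} _ p q = inj₂ (inj₁ λ _ ())
  compare {suc K} K<n p q with compare (ℕ.<⇒≤ K<n) p q
  ... | inj₁ p≺q = inj₁ (≺-mono p q (ℕ.n≤1+n K) p≺q)
  ... | inj₂ (inj₁ p≈q) = compare-next p q (fromℕ< K<n) (toℕ-fromℕ< K<n) p≈q
  ... | inj₂ (inj₂ q≺p) = inj₂ (inj₂ (≺-mono q p (ℕ.n≤1+n K) q≺p))

  ≺-cotrans : ∀ {K} → K ℕ.≤ n → ∀ (p r : ℚ^ n) → p ≺[ K ] r → ∀ q → p ≺[ K ] q ⊎ q ≺[ K ] r
  ≺-cotrans K≤n p r p≺r q with compare K≤n p q
  ... | inj₁ p≺q = inj₁ p≺q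
  ... | inj₂ (inj₁ p≈q) = inj₂ (≈-≺-trans q p r (≈-sym p q p≈q) p≺r)
  ... | inj₂ (inj₂ q≺p) = inj₂ (≺-trans q p r q≺p p≺r)

  ≤X-trans : Transitive (_≤X_ {n})
  ≤X-trans (inj₁ refl) y≤z = y≤z
  ≤X-trans (inj₂ x<y) (inj₁ refl) = inj₂ x<y
  ≤X-trans {x} {y} {z} (inj₂ (_ , x<y)) (inj₂ (_ , y<z)) =
    let (k , _ , x<z) = L-trans (proj₁ x) (proj₁ y) (proj₁ z) x<y y<z in inj₂ (k , x<z)

lemma3p9 : (n : ℕ) → 1 Data.Nat.≤ n → (i j : ℤ) →
    -[1+ n ] ≤ i → i ≤ +[1+ n ] → -[1+ n ] ≤ j → j ≤ +[1+ n ] →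
    ∣ j ∣ ≡ ∣ i ∣ →
    ∀ (x y : X n) →
    ((R n i ∘ᵣ R n j) x y → R n (i ⊓ j) x y) × (R n (i ⊓ j) x y → (R n i ∘ᵣ R n j) x y)
lemma3p9 n _ (+ zero) (+ zero) _ _ _ _ _ = preorder-∘-idem (inj₁ refl) ≤X-trans
lemma3p9 n _ -[1+ m ] -[1+ .m ] _ _ _ _ refl rewrite ℕ.⊔-idem m =
  Strict∘Strict (_≺[ n ∸ m ]_) ≺-trans ≺-dense
lemma3p9 n _ -[1+ m ] +[1+ .m ] _ _ _ _ refl =
  Strict∘Weak (_≺[ n ∸ m ]_) ≺-irrefl (≺-cotrans (ℕ.m∸n≤m n m))
lemma3p9 n _ +[1+ m ] -[1+ .m ] _ _ _ _ refl =
  Weak∘Strict (_≺[ n ∸ m ]_) ≺-irrefl (≺-cotrans (ℕ.m∸n≤m n m))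
lemma3p9 n _ +[1+ m ] +[1+ .m ] _ _ _ _ refl rewrite ℕ.⊓-idem m =
  Weak∘Weak (_≺[ n ∸ m ]_) ≺-irrefl (≺-cotrans (ℕ.m∸n≤m n m))
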